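{- Let $X$ be a finite nonempty set of integers and let $B$ be an infinite set of integers with $B \cap \mathbb{Z}_{<0}$ finite. Define $$\eta := \min\{\, |b - b'| \;:\; b, b' \in B,\ b \neq b',\ |b - b'| \geq \mathrm{diam}(X) \,\}.$$ Then for all $u, v \in \mathbb{N}$ and every positive integer $g$: $$(uB + vX)(m) \leq \eta \cdot ((u+v)B)(m) + O(1) \quad (m \to +\infty),$$ and $$\left| \frac{uB + vX}{g\mathbb{Z}} \right| \leq \eta \left| \frac{(u+v)B}{g\mathbb{Z}} \right|.$$
   Context: $\mathbb{N} = \{0,1,2,\dots\}$. For sets $S,T$ of integers, $S+T := \{s+t : s\in S, t\in T\}$, and for $n \in \mathbb{N}$, $nS$ denotes the set of sums of $n$ (not necessarily distinct) elements of $S$, with $0S = \{0\}$. For a set $U$ of integers with $U \cap \mathbb{Z}_{<0}$ finite, $U(m)$ denotes the number of elements of $U$ that are $\leq m$. For a set $S$ of integers, $\frac{S}{g\mathbb{Z}}$ denotes the image of $S$ in $\mathbb{Z}/g\mathbb{Z}$ under the canonical surjection. $\mathrm{diam}(X) := \max_{x,y\in X}|x-y|$. -}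

module Defs where

open import Level using (0ℓ)
open import Data.Nat as ℕ using (ℕ; _⊔_; NonZero)
open import Data.Integer as ℤ using (ℤ; _+_; _-_; ∣_∣; +_; _<_)
open import Data.Integer.DivMod using (_%ℕ_)
open import Data.List using (List; []; _∷_; map; concatMap; foldr; length)
open import Data.List.Membership.Propositional using (_∈_)
open import Data.List.Relation.Unary.Unique.Propositional using (Unique)
open import Data.Product using (Σ; ∃; ∃-syntax; _×_; _,_)
open import Relation.Binary.PropositionalEquality using (_≡_; _≢_)
open import Relation.Nullary using (¬_)
open import Relation.Unary using (Pred)
open import Function.Bundles using (_⇔_)

ℤSet : Set₁
ℤSet = Pred ℤ 0ℓ

_⊕_ : ℤSet → ℤSet → ℤSet
(S ⊕ T) z = ∃[ s ] ∃[ t ] (S s × T t × z ≡ s + t)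

_·_ : ℕ → ℤSet → ℤSet
(ℕ.zero · S) z = z ≡ + 0
(ℕ.suc n · S) = S ⊕ (n · S)

⟦_⟧ : List ℤ → ℤSet
⟦ X ⟧ x = x ∈ X

diam : List ℤ → ℕ
diam X = foldr _⊔_ 0 (concatMap (λ x → map (λ y → ∣ x - y ∣) X) X)

HasCard : {A : Set} → Pred A 0ℓ → ℕ → Set
HasCard {A} P k = ∃[ l ] (Unique l × (∀ x → (x ∈ l ⇔ P x)) × length l ≡ k)

Finite : ℤSet → Set
Finite S = ∃[ l ] (∀ x → S x → x ∈ l)

Infinite : ℤSet → Set
Infinite S = ¬ Finite S

FinitelyManyNeg : ℤSet → Set
FinitelyManyNeg B = Finite (λ x → B x × x < + 0)

-- U(m) = k : the number of elements of U that are ≤ m is k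
CountIs : ℤSet → ℤ → ℕ → Set
CountIs U m k = HasCard (λ x → U x × x ℤ.≤ m) k

-- image of S in ℤ/gℤ, residues represented by 0..g-1
Residues : ℤSet → (g : ℕ) → .{{NonZero g}} → Pred ℕ 0ℓ
Residues S g r = ∃[ s ] (S s × s %ℕ g ≡ r)

EtaSet : List ℤ → ℤSet → Pred ℕ 0ℓ
EtaSet X B d = ∃[ b ] ∃[ b' ] (B b × B b' × b ≢ b' × ∣ b - b' ∣ ≡ d × diam X ℕ.≤ d)

IsEta : List ℤ → ℤSet → ℕ → Set
IsEta X B η = EtaSet X B η × (∀ d → EtaSet X B d → η ℕ.≤ d)

{-# OPTIONS --safe #-}
-- Since η ≥ diam X, every x ∈ X lies in [x₀, x₀ + η] with x₀ = min X, so an element of vX is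
-- v x₀ + n with 0 ≤ n ≤ vη. Write n = qη + r with 0 ≤ r < η and take b, b + η ∈ B: then
-- v b + qη ∈ vB. Hence uB + vX is covered by the η translates (u+v)B + e + r, r < η, where
-- e = v x₀ − v b. Consequently each residue of uB + vX mod g comes from one of η shifts of a
-- residue of (u+v)B, and each element ≤ m from one of η shifts of an element of (u+v)B that is
-- ≤ m + |e|; at most |e| of the latter exceed m.
module Submission where

open import Defs
open import Level using (0ℓ)
open import Data.Nat as ℕ using (ℕ; zero; suc; z≤n; s≤s; NonZero; ≢-nonZero)
import Data.Nat.Properties as ℕₚ
open import Data.Fin using (Fin; zero; suc; toℕ; fromℕ<; combine; remQuot; splitAt; _↑ˡ_; _↑ʳ_)
open import Data.Fin.Properties using (toℕ-fromℕ<; remQuot-combine; splitAt-↑ˡ; splitAt-↑ʳ; injective⇒≤)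
open import Data.Integer using (ℤ; +_; ∣_∣)
open import Data.List using (List; []; _∷_; length; lookup; foldr; map)
open import Data.List.Relation.Unary.All as All using (_∷_)
open import Data.List.Relation.Unary.AllPairs using (_∷_)
open import Data.List.Relation.Unary.Any as Any using (here; there; index)
open import Data.List.Relation.Unary.Any.Properties using (lookup-index)
open import Data.List.Membership.Propositional using (_∈_)
open import Data.List.Membership.Propositional.Properties using (∈-lookup; ∈-map⁺; ∈-concatMap⁺)
open import Data.List.Relation.Unary.Unique.Propositional using (Unique)
open import Data.Product using (Σ-syntax; ∃-syntax; _×_; _,_; proj₁; proj₂; uncurry)
open import Data.Sum using (inj₁; inj₂; [_,_]′)
open import Data.Empty using (⊥-elim)
open import Function using (_∘_; id)
open import Function.Bundles using (Equivalence)
open import Function.Definitions using (Injective)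
open import Relation.Binary.PropositionalEquality using (_≡_; _≢_; refl; sym; trans; cong; subst; subst₂; module ≡-Reasoning)
open import Relation.Nullary using (yes; no)
open import Relation.Unary using (Pred; _⊆_; _∪_)

open Equivalence using (to; from)

private
  variable
    A C D : Set
    k m n : ℕ

Covers : ℕ → Pred A 0ℓ → Set
Covers {A} n P = Σ[ f ∈ (Fin n → A) ] P ⊆ (λ x → ∃[ c ] f c ≡ x)

Unique-lookup-injective : {xs : List A} → Unique xs → Injective _≡_ _≡_ (lookup xs)
Unique-lookup-injective (_ ∷ _)      {zero}  {zero}  _       = refl
Unique-lookup-injective (x∉xs ∷ _)   {zero}  {suc j} x≡xs[j] =
  ⊥-elim (All.lookup x∉xs (∈-lookup j) x≡xs[j])
Unique-lookup-injective (x∉xs ∷ _)   {suc i} {zero}  xs[i]≡x =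
  ⊥-elim (All.lookup x∉xs (∈-lookup i) (sym xs[i]≡x))
Unique-lookup-injective (_ ∷ unique) {suc i} {suc j} eq      = cong suc (Unique-lookup-injective unique eq)

HasCard⇒Covers : {P : Pred A 0ℓ} → HasCard P k → Covers k P
HasCard⇒Covers (l , _ , l⇔P , refl) = lookup l , λ {x} Px →
  let x∈l = from (l⇔P x) Px in index x∈l , sym (lookup-index x∈l)

HasCard-≤-Covers : {P : Pred A 0ℓ} → HasCard P k → Covers n P → k ℕ.≤ n
HasCard-≤-Covers {n = n} {P = P} (l , unique , l⇔P , refl) (f , P⊆) = injective⇒≤ code-injective
  where
  covered : ∀ i → P (lookup l i)
  covered i = to (l⇔P _) (∈-lookup i)

  code : Fin (length l) → Fin n
  code i = proj₁ (P⊆ (covered i))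

  f∘code : ∀ i → f (code i) ≡ lookup l i
  f∘code i = proj₂ (P⊆ (covered i))

  code-injective : Injective _≡_ _≡_ code
  code-injective {i} {j} ci≡cj = Unique-lookup-injective unique (begin
    lookup l i    ≡⟨ sym (f∘code i) ⟩
    f (code i)    ≡⟨ cong f ci≡cj ⟩
    f (code j)    ≡⟨ f∘code j ⟩
    lookup l j    ∎)
    where open ≡-Reasoning

Covers-⊆ : {P Q : Pred A 0ℓ} → P ⊆ Q → Covers n Q → Covers n P
Covers-⊆ P⊆Q (f , Q⊆) = f , Q⊆ ∘ P⊆Q

Covers-∪ : {P Q : Pred A 0ℓ} → Covers m P → Covers n Q → Covers (m ℕ.+ n) (P ∪ Q)
Covers-∪ {m = m} {n = n} {P = P} {Q = Q} (f , P⊆) (g , Q⊆) = [ f , g ]′ ∘ splitAt m , cover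
  where
  cover : P ∪ Q ⊆ (λ x → ∃[ c ] [ f , g ]′ (splitAt m c) ≡ x)
  cover (inj₁ Px) = let c , fc≡x = P⊆ Px in
    c ↑ˡ n , trans (cong [ f , g ]′ (splitAt-↑ˡ m c n)) fc≡x
  cover (inj₂ Qx) = let c , gc≡x = Q⊆ Qx in
    m ↑ʳ c , trans (cong [ f , g ]′ (splitAt-↑ʳ m n c)) gc≡x

Covers-image₂ : (h : A → C → D) {P : Pred A 0ℓ} {Q : Pred C 0ℓ} {R : Pred D 0ℓ} →
  Covers m P → Covers n Q → R ⊆ (λ z → ∃[ x ] ∃[ y ] (P x × Q y × h x y ≡ z)) →
  Covers (m ℕ.* n) R
Covers-image₂ {D = D} {m = m} {n = n} h {R = R} (f , P⊆) (g , Q⊆) R⊆ = h′ ∘ remQuot n , cover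
  where
  h′ : Fin m × Fin n → D
  h′ = uncurry (λ i j → h (f i) (g j))

  cover : R ⊆ (λ z → ∃[ c ] h′ (remQuot n c) ≡ z)
  cover Rz with R⊆ Rz
  ... | x , y , Px , Qy , refl with P⊆ Px | Q⊆ Qy
  ... | i , refl | j , refl = combine i j , cong h′ (remQuot-combine i j)

Covers-< : Covers n (ℕ._< n)
Covers-< = toℕ , λ d<n → fromℕ< d<n , toℕ-fromℕ< d<n

module _ where
  open Data.Integer using (-[1+_]; +[1+_]; _+_; _-_; _*_; -_; _≤_; _<_; _≤?_; -≤+; drop‿+≤+)
  open import Data.Integer.Properties
  open import Data.Integer.DivMod using (_%ℕ_; _/ℕ_; n%ℕd<d; a≡a%ℕn+[a/ℕn]*n)
  open import Data.Integer.Solver using (module +-*-Solver)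
  open +-*-Solver using (solve; _:=_; _:+_; _:*_; _:-_; :-_; con)
  open import Data.Nat.DivMod using (_/_; _%_; m%n<n; m≡m%n+[m/n]*n; m*n/n≡m; /-monoˡ-≤)
  open import Data.List.Extrema ≤-totalOrder using (min; min≤⊤; min≤xs; argmin-sel)

  i≤j⇒j≡i+∣j-i∣ : ∀ {i j} → i ≤ j → j ≡ i + + ∣ j - i ∣
  i≤j⇒j≡i+∣j-i∣ {i} {j} i≤j = begin
    j               ≡⟨ solve 2 (λ i j → j := i :+ (j :- i)) refl i j ⟩
    i + (j - i)     ≡⟨ cong (λ t → i + t) (sym (0≤i⇒+∣i∣≡i (i≤j⇒0≤j-i i≤j))) ⟩
    i + + ∣ j - i ∣ ∎
    where open ≡-Reasoning

  i≤+∣i∣ : ∀ i → i ≤ + ∣ i ∣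
  i≤+∣i∣ (+ n)    = ≤-refl
  i≤+∣i∣ -[1+ n ] = -≤+

  +-cancelˡ-≤ : ∀ i {j k} → i + j ≤ i + k → j ≤ k
  +-cancelˡ-≤ i {j} {k} i+j≤i+k =
    subst₂ _≤_ (-i+[i+j]≡j j) (-i+[i+j]≡j k) (+-monoʳ-≤ (- i) i+j≤i+k)
    where
    -i+[i+j]≡j : ∀ j → - i + (i + j) ≡ j
    -i+[i+j]≡j j = solve 2 (λ i j → :- i :+ (i :+ j) := j) refl i j

  Covers-interval : ∀ m K → Covers K (λ w → m < w × w ≤ m + + K)
  Covers-interval m K = (λ c → m + + suc (toℕ c)) , cover
    where
    cover : ∀ {w} → m < w × w ≤ m + + K → ∃[ c ] m + + suc (toℕ c) ≡ w
    cover {w} (m<w , w≤m+K) with ∣ w - m ∣ | i≤j⇒j≡i+∣j-i∣ (<⇒≤ m<w)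
    ... | zero  | w≡m+0 = ⊥-elim (<-irrefl (sym (trans w≡m+0 (+-identityʳ m))) m<w)
    ... | suc n | refl  = fromℕ< n<K , cong (λ t → m + + suc t) (toℕ-fromℕ< n<K)
      where
      n<K : n ℕ.< K
      n<K = drop‿+≤+ (+-cancelˡ-≤ m w≤m+K)

  CountIs⇒Covers-≤m+K : ∀ {T m k} K → CountIs T m k →
    Covers (k ℕ.+ K) (λ w → T w × w ≤ m + + K)
  CountIs⇒Covers-≤m+K {T} {m} K T≤m =
    Covers-⊆ split (Covers-∪ (HasCard⇒Covers T≤m) (Covers-interval m K))
    where
    split : (λ w → T w × w ≤ m + + K) ⊆ (λ w → T w × w ≤ m) ∪ (λ w → m < w × w ≤ m + + K)
    split {w} (Tw , w≤m+K) with w ≤? m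
    ... | yes w≤m = inj₁ (Tw , w≤m)
    ... | no  w≰m = inj₂ (≰⇒> w≰m , w≤m+K)

  +a≡+b+[1+n]g⇒g≤a : ∀ {a b g} n → + a ≡ + b + +[1+ n ] * + g → g ℕ.≤ a
  +a≡+b+[1+n]g⇒g≤a {a} {b} {g} n +a≡+b+[1+n]g =
    subst (g ℕ.≤_) (sym a≡b+[1+n]g) (ℕₚ.≤-trans (ℕₚ.m≤m+n g (n ℕ.* g)) (ℕₚ.m≤n+m _ b))
    where
    a≡b+[1+n]g : a ≡ b ℕ.+ suc n ℕ.* g
    a≡b+[1+n]g = +-injective (begin
      + a                     ≡⟨ +a≡+b+[1+n]g ⟩
      + b + +[1+ n ] * + g    ≡⟨ cong (λ t → + b + t) (sym (pos-* (suc n) g)) ⟩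
      + (b ℕ.+ suc n ℕ.* g)   ∎)
      where open ≡-Reasoning

  residue-unique : ∀ {g r r′} t → r ℕ.< g → r′ ℕ.< g → + r′ ≡ + r + t * + g → r′ ≡ r
  residue-unique (+ zero)  _   _    r′≡r+0 = +-injective (trans r′≡r+0 (+-identityʳ _))
  residue-unique +[1+ n ]  _   r′<g eq     = ⊥-elim (ℕₚ.<⇒≱ r′<g (+a≡+b+[1+n]g⇒g≤a n eq))
  residue-unique {g} {r} {r′} -[1+ n ] r<g _ eq =
    ⊥-elim (ℕₚ.<⇒≱ r<g (+a≡+b+[1+n]g⇒g≤a n r≡r′+[1+n]g))
    where
    r≡r′+[1+n]g : + r ≡ + r′ + +[1+ n ] * + g
    r≡r′+[1+n]g = trans
      (solve 3 (λ r t g → r := (r :+ (:- t) :* g) :+ t :* g) refl (+ r) +[1+ n ] (+ g))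
      (cong (_+ +[1+ n ] * + g) (sym eq))

  %ℕ-unique : ∀ {g} .{{_ : NonZero g}} {i r} q → r ℕ.< g → i ≡ + r + q * + g → i %ℕ g ≡ r
  %ℕ-unique {g} {i} {r} q r<g i≡r+qg = residue-unique (q - i /ℕ g) r<g (n%ℕd<d i g) (begin
    + (i %ℕ g)
      ≡⟨ solve 3 (λ ρ q g → ρ := (ρ :+ q :* g) :- q :* g) refl (+ (i %ℕ g)) (i /ℕ g) (+ g) ⟩
    + (i %ℕ g) + i /ℕ g * + g - i /ℕ g * + g
      ≡⟨ cong (_- i /ℕ g * + g) (trans (sym (a≡a%ℕn+[a/ℕn]*n i g)) i≡r+qg) ⟩
    + r + q * + g - i /ℕ g * + g
      ≡⟨ solve 4 (λ r q q′ g → r :+ q :* g :- q′ :* g := r :+ (q :- q′) :* g)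
                 refl (+ r) q (i /ℕ g) (+ g) ⟩
    + r + (q - i /ℕ g) * + g
      ∎)
    where open ≡-Reasoning

  %ℕ-+ˡ : ∀ {g} .{{_ : NonZero g}} i j → (+ (i %ℕ g) + j) %ℕ g ≡ (i + j) %ℕ g
  %ℕ-+ˡ {g} i j = sym (%ℕ-unique (s /ℕ g + i /ℕ g) (n%ℕd<d s g) (begin
    i + j
      ≡⟨ cong (_+ j) (a≡a%ℕn+[a/ℕn]*n i g) ⟩
    + (i %ℕ g) + i /ℕ g * + g + j
      ≡⟨ solve 4 (λ r q g j → r :+ q :* g :+ j := (r :+ j) :+ q :* g) refl (+ (i %ℕ g)) (i /ℕ g) (+ g) j ⟩
    s + i /ℕ g * + g
      ≡⟨ cong (_+ i /ℕ g * + g) (a≡a%ℕn+[a/ℕn]*n s g) ⟩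
    + (s %ℕ g) + s /ℕ g * + g + i /ℕ g * + g
      ≡⟨ solve 4 (λ r q q′ g → r :+ q :* g :+ q′ :* g := r :+ (q :+ q′) :* g)
                 refl (+ (s %ℕ g)) (s /ℕ g) (i /ℕ g) (+ g) ⟩
    + (s %ℕ g) + (s /ℕ g + i /ℕ g) * + g
      ∎))
    where
    open ≡-Reasoning
    s : ℤ
    s = + (i %ℕ g) + j

  CoveredByTranslates : ℕ → ℤ → ℤSet → ℤSet → Set
  CoveredByTranslates η e S T = S ⊆ λ s → ∃[ d ] ∃[ w ] (d ℕ.< η × T w × w + (e + + d) ≡ s)

  i+[j+n]≤m⇒i≤m+∣j∣ : ∀ {i j m} n → i + (j + + n) ≤ m → i ≤ m + + ∣ j ∣
  i+[j+n]≤m⇒i≤m+∣j∣ {i} {j} {m} n s≤m = begin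
    i                       ≡⟨ solve 3 (λ i j n → i := i :+ (j :+ n) :- j :- n) refl i j (+ n) ⟩
    i + (j + + n) - j - + n ≤⟨ i-j≤i _ (+ n) ⟩
    i + (j + + n) - j       ≤⟨ +-mono-≤ s≤m (i≤+∣i∣ (- j)) ⟩
    m + + ∣ - j ∣           ≡⟨ cong (λ t → m + + t) (∣-i∣≡∣i∣ j) ⟩
    m + + ∣ j ∣             ∎
    where open ≤-Reasoning

  count-≤ : ∀ {η e S T m k k′} → CoveredByTranslates η e S T →
    CountIs S m k → CountIs T m k′ → k ℕ.≤ η ℕ.* k′ ℕ.+ η ℕ.* ∣ e ∣
  count-≤ {η} {e} {S} {T} {m} {k} {k′} S⊆ S≤m T≤m = subst (k ℕ.≤_) (ℕₚ.*-distribˡ-+ η k′ ∣ e ∣)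
    (HasCard-≤-Covers S≤m
      (Covers-image₂ (λ d w → w + (e + + d)) Covers-< (CountIs⇒Covers-≤m+K ∣ e ∣ T≤m) split))
    where
    split : (λ s → S s × s ≤ m) ⊆
            (λ s → ∃[ d ] ∃[ w ] (d ℕ.< η × (T w × w ≤ m + + ∣ e ∣) × w + (e + + d) ≡ s))
    split (Ss , s≤m) with S⊆ Ss
    ... | d , w , d<η , Tw , refl = d , w , d<η , (Tw , i+[j+n]≤m⇒i≤m+∣j∣ {j = e} d s≤m) , refl

  residues-≤ : ∀ {η e S T} → CoveredByTranslates η e S T →
    ∀ (g : ℕ) .{{_ : NonZero g}} → ∀ k k′ →
    HasCard (Residues S g) k → HasCard (Residues T g) k′ → k ℕ.≤ η ℕ.* k′
  residues-≤ {η} {e} {S} {T} S⊆ g k k′ S%g T%g =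
    HasCard-≤-Covers S%g
      (Covers-image₂ (λ d ρ → (+ ρ + (e + + d)) %ℕ g) Covers-< (HasCard⇒Covers T%g) split)
    where
    split : Residues S g ⊆
            (λ r → ∃[ d ] ∃[ ρ ] (d ℕ.< η × Residues T g ρ × (+ ρ + (e + + d)) %ℕ g ≡ r))
    split (s , Ss , refl) with S⊆ Ss
    ... | d , w , d<η , Tw , refl = d , w %ℕ g , d<η , (w , Tw , refl) , %ℕ-+ˡ w (e + + d)

  [_,+_] : ℤ → ℕ → ℤSet
  [ a ,+ δ ] x = ∃[ n ] (n ℕ.≤ δ × x ≡ a + + n)

  [,+]-mono : ∀ {a δ δ′} → δ ℕ.≤ δ′ → [ a ,+ δ ] ⊆ [ a ,+ δ′ ]
  [,+]-mono δ≤δ′ (n , n≤δ , x≡a+n) = n , ℕₚ.≤-trans n≤δ δ≤δ′ , x≡a+n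

  ·-⊆-[,+] : ∀ {S a δ} v → S ⊆ [ a ,+ δ ] → v · S ⊆ [ + v * a ,+ v ℕ.* δ ]
  ·-⊆-[,+] zero _ refl = 0 , z≤n , refl
  ·-⊆-[,+] {a = a} {δ} (suc v) S⊆ (x , y , Sx , vSy , refl)
    with S⊆ Sx | ·-⊆-[,+] {a = a} {δ} v S⊆ vSy
  ... | n , n≤δ , refl | n′ , n′≤vδ , refl = n ℕ.+ n′ , ℕₚ.+-mono-≤ n≤δ n′≤vδ ,
    solve 4 (λ a n v n′ → a :+ n :+ (v :* a :+ n′) := (con (+ 1) :+ v) :* a :+ (n :+ n′))
            refl a (+ n) (+ v) (+ n′)

  ·-progression : ∀ {B b η} → B b → B (b + + η) →
    ∀ v {j} → j ℕ.≤ v → (v · B) (+ v * b + + (j ℕ.* η))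
  ·-progression _ _ zero z≤n = refl
  ·-progression {b = b} Bb Bb+η (suc v) {zero} _ = b , _ , Bb , ·-progression Bb Bb+η v z≤n ,
    solve 2 (λ v b → (con (+ 1) :+ v) :* b :+ con (+ 0) := b :+ (v :* b :+ con (+ 0))) refl (+ v) b
  ·-progression {b = b} {η} Bb Bb+η (suc v) {suc j} (s≤s j≤v) =
    b + + η , _ , Bb+η , ·-progression Bb Bb+η v j≤v ,
    solve 4 (λ v b η jη → (con (+ 1) :+ v) :* b :+ (η :+ jη) := (b :+ η) :+ (v :* b :+ jη))
            refl (+ v) b (+ η) (+ (j ℕ.* η))

  ·-⊕-⊆ : ∀ {B} u {v} → (u · B) ⊕ (v · B) ⊆ (u ℕ.+ v) · B
  ·-⊕-⊆ {B} zero {v} (_ , c , refl , vBc , refl) = subst (v · B) (sym (+-identityˡ c)) vBc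
  ·-⊕-⊆ (suc u) (_ , c , (x , a , Bx , uBa , refl) , vBc , refl) =
    x , a + c , Bx , ·-⊕-⊆ u (a , c , uBa , vBc , refl) , +-assoc x a c

  -- With n = qη + r, the part qη is supplied by q summands b + η and v − q summands b.
  sumset-CoveredByTranslates : ∀ {S B x₀ b η} .{{_ : NonZero η}} →
    S ⊆ [ x₀ ,+ η ] → B b → B (b + + η) →
    ∀ u v → CoveredByTranslates η (+ v * x₀ - + v * b) ((u · B) ⊕ (v · S)) ((u ℕ.+ v) · B)
  sumset-CoveredByTranslates {x₀ = x₀} {b} {η} S⊆ Bb Bb+η u v (a , _ , uBa , vSy , refl)
    with ·-⊆-[,+] {a = x₀} {η} v S⊆ vSy
  ... | n , n≤vη , refl = n % η , a + (+ v * b + + (n / η ℕ.* η)) , m%n<n n η ,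
    ·-⊕-⊆ u (a , _ , uBa , ·-progression Bb Bb+η v n/η≤v , refl) , sum≡
    where
    n/η≤v : n / η ℕ.≤ v
    n/η≤v = subst (n / η ℕ.≤_) (m*n/n≡m v η) (/-monoˡ-≤ η n≤vη)

    sum≡ : a + (+ v * b + + (n / η ℕ.* η)) + (+ v * x₀ - + v * b + + (n % η)) ≡
           a + (+ v * x₀ + + n)
    sum≡ = begin
      a + (+ v * b + + (n / η ℕ.* η)) + (+ v * x₀ - + v * b + + (n % η))
        ≡⟨ solve 6 (λ a v b x₀ q r → a :+ (v :* b :+ q) :+ (v :* x₀ :- v :* b :+ r) :=
                                     a :+ (v :* x₀ :+ (r :+ q)))
                   refl a (+ v) b x₀ (+ (n / η ℕ.* η)) (+ (n % η)) ⟩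
      a + (+ v * x₀ + + (n % η ℕ.+ n / η ℕ.* η))
        ≡⟨ cong (λ t → a + (+ v * x₀ + + t)) (sym (m≡m%n+[m/n]*n n η)) ⟩
      a + (+ v * x₀ + + n) ∎
      where open ≡-Reasoning

  translate-pair : ∀ (P : ℤSet) {i j d} → P i → P j → ∣ i - j ∣ ≡ d → ∃[ b ] (P b × P (b + + d))
  translate-pair P {i} {j} Pi Pj refl with ≤-total i j
  ... | inj₁ i≤j =
    i , Pi , subst P (trans (i≤j⇒j≡i+∣j-i∣ i≤j) (cong (λ t → i + + t) (∣i-j∣≡∣j-i∣ j i))) Pj
  ... | inj₂ j≤i = j , Pj , subst P (i≤j⇒j≡i+∣j-i∣ j≤i) Pi

  ≤-foldr-⊔ : ∀ {n ns} → n ∈ ns → n ℕ.≤ foldr ℕ._⊔_ 0 ns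
  ≤-foldr-⊔                (here refl)  = ℕₚ.m≤m⊔n _ _
  ≤-foldr-⊔ {ns = n′ ∷ _} (there n∈ns) = ℕₚ.≤-trans (≤-foldr-⊔ n∈ns) (ℕₚ.m≤n⊔m n′ _)

  ∣-∣≤diam : ∀ {X x y} → x ∈ X → y ∈ X → ∣ x - y ∣ ℕ.≤ diam X
  ∣-∣≤diam {X} {x} {y} x∈X y∈X = ≤-foldr-⊔ (∈-concatMap⁺ (λ x → map (λ y → ∣ x - y ∣) X)
    (Any.map (λ { refl → ∈-map⁺ (λ y → ∣ x - y ∣) y∈X }) x∈X))

  ⟦⟧⊆[min,+diam] : ∀ x xs → ⟦ x ∷ xs ⟧ ⊆ [ min x xs ,+ diam (x ∷ xs) ]
  ⟦⟧⊆[min,+diam] x xs {y} y∈X = ∣ y - min x xs ∣ , ∣-∣≤diam y∈X min∈X , i≤j⇒j≡i+∣j-i∣ min≤y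
    where
    min∈X : min x xs ∈ x ∷ xs
    min∈X = [ here , there ]′ (argmin-sel id x xs)

    min≤y : min x xs ≤ y
    min≤y = All.lookup (min≤⊤ x xs ∷ min≤xs x xs) y∈X

  EtaSet⇒CoveredByTranslates : ∀ {x xs B η} → EtaSet (x ∷ xs) B η → ∀ u v →
    ∃[ e ] CoveredByTranslates η e ((u · B) ⊕ (v · ⟦ x ∷ xs ⟧)) ((u ℕ.+ v) · B)
  EtaSet⇒CoveredByTranslates {x} {xs} {B} {η} (b₁ , b₂ , Bb₁ , Bb₂ , b₁≢b₂ , ∣b₁-b₂∣≡η , diam≤η) u v
    with translate-pair B Bb₁ Bb₂ ∣b₁-b₂∣≡η
  ... | b , Bb , Bb+η = + v * min x xs - + v * b ,
    sumset-CoveredByTranslates {B = B} {x₀ = min x xs} {b} {{≢-nonZero η≢0}} X⊆ Bb Bb+η u v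
    where
    X⊆ : ⟦ x ∷ xs ⟧ ⊆ [ min x xs ,+ η ]
    X⊆ y∈X = [,+]-mono {a = min x xs} diam≤η (⟦⟧⊆[min,+diam] x xs y∈X)

    η≢0 : η ≢ 0
    η≢0 η≡0 = b₁≢b₂ (i-j≡0⇒i≡j b₁ b₂ (∣i∣≡0⇒i≡0 (trans ∣b₁-b₂∣≡η η≡0)))

open import Data.Nat using (_+_; _*_; _≤_)

lemma2 : (X : List ℤ) → X ≢ [] → (B : ℤSet) → Infinite B → FinitelyManyNeg B →
    (η : ℕ) → IsEta X B η → (u v : ℕ) →
    (∃[ C ] ∃[ M ] (∀ (m : ℤ) → M Data.Integer.≤ m → ∀ k k' →
        CountIs ((u · B) ⊕ (v · ⟦ X ⟧)) m k → CountIs ((u + v) · B) m k' →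
        k ≤ η * k' + C))
    × (∀ (g : ℕ) .{{_ : NonZero g}} → ∀ k k' →
        HasCard (Residues ((u · B) ⊕ (v · ⟦ X ⟧)) g) k →
        HasCard (Residues ((u + v) · B) g) k' →
        k ≤ η * k')
lemma2 [] X≢[] = ⊥-elim (X≢[] refl)
lemma2 (x ∷ xs) _ B _ _ η (η∈EtaSet , _) u v with EtaSet⇒CoveredByTranslates η∈EtaSet u v
... | e , covered =
  (η * ∣ e ∣ , + 0 , λ m _ k k′ → count-≤ {e = e} covered) , residues-≤ {e = e} covered
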